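{- Let $\gamma_1=\begin{pmatrix}1&1\\0&1\end{pmatrix}$. The action $\mu\mapsto\mu|_k\gamma_1$ on $\mathcal{D}$, given by $(\mu|_k\gamma_1)(z^n)=\sum_{l=0}^n\binom{n}{l}\mu(z^l)$, does not depend on $k$. Moreover: (1) there is no nonzero $\mu\in\mathcal{D}$ with $\mu|_k\gamma_1=\mu$; (2) for every nonzero $\mu\in\mathcal{D}$, $\operatorname{ord}_w(\mathcal{C}(\mu))<\operatorname{ord}_w(\mathcal{C}(\mu|_k\gamma_1-\mu))$, and the image $\{\mu|_k\gamma_1-\mu:\mu\in\mathcal{D}\}$ equals the set of $\mu\in\mathcal{D}$ with $\mu(1)=0$, i.e. whose Cauchy transform has zero constant term.
   Context: $p$ is a prime. $\mathcal{D}$ is the space of $\mathbb{Q}_p$-linear forms $\mu$ on $\mathbb{Q}_p[z]$, with Cauchy transform $\mathcal{C}(\mu)=\sum_{j\ge0}\mu(z^j)w^j\in\mathbb{Q}_p[[w]]$; $\operatorname{ord}_w$ is the $w$-adic valuation. For an upper triangular matrix $\begin{pmatrix}a&b\\0&d\end{pmatrix}$ the weight-$k$ action is $(\mu|_k\gamma)(z^n)=\int a^{k-2-n}(b+dz)^n\,d\mu$ (expanded by the binomial formula). -}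

module Defs where

open import Level using (_⊔_) renaming (suc to lsuc)
open import Algebra.Bundles using (CommutativeRing; Semiring)
open import Data.Nat as ℕ using (ℕ; zero; suc; _<_; _∸_)
open import Data.Nat.Combinatorics using (_C_)
open import Data.Fin using (Fin; toℕ)
open import Data.Integer as ℤ using (ℤ; +_; -[1+_])
open import Data.Product using (Σ; _×_; proj₁)
open import Relation.Nullary using (¬_)
import Algebra.Definitions.RawMonoid as RawMonoidDefs
import Algebra.Definitions.RawSemiring as RawSemiringDefs

record CharZeroField c ℓ : Set (lsuc (c ⊔ ℓ)) where
  field
    commutativeRing : CommutativeRing c ℓ
  open CommutativeRing commutativeRing public
  open RawMonoidDefs +-rawMonoid public using (sum) renaming (_×_ to _·_)
  open RawSemiringDefs (Semiring.rawSemiring semiring) public using (_^_)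
  field
    inverse  : ∀ x → ¬ (x ≈ 0#) → Σ Carrier λ y → x * y ≈ 1#
    charZero : ∀ n → ¬ ((suc n · 1#) ≈ 0#)

module Dist {c ℓ} (F : CharZeroField c ℓ) where
  open CharZeroField F

  -- A linear form μ on K[z] is determined by (and determines) its moments μ(z^n).
  𝒟 : Set c
  𝒟 = ℕ → Carrier

  PowerSeries : Set c
  PowerSeries = ℕ → Carrier

  -- Cauchy transform C(μ) = Σ_j μ(z^j) w^j.
  Cauchy : 𝒟 → PowerSeries
  Cauchy μ j = μ j

  IsOrd : PowerSeries → ℕ → Set ℓ
  IsOrd f m = ¬ (f m ≈ 0#) × (∀ j → j < m → f j ≈ 0#)

  NonZero𝒟 : 𝒟 → Set ℓ
  NonZero𝒟 μ = ¬ (∀ n → μ n ≈ 0#)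

  zpow : (a : Carrier) → ¬ (a ≈ 0#) → ℤ → Carrier
  zpow a _  (+ n)     = a ^ n
  zpow a na -[1+ n ]  = proj₁ (inverse a na) ^ suc n

  record UpperTri : Set (c ⊔ ℓ) where
    constructor upperTri
    field
      a b d : Carrier
      a≉0   : ¬ (a ≈ 0#)

  slash : ℤ → UpperTri → 𝒟 → 𝒟
  slash k (upperTri a b d a≉0) μ n =
    sum (λ (l : Fin (suc n)) →
      (((n C toℕ l) · 1#) * zpow a a≉0 (k ℤ.- + 2 ℤ.- + n))
        * ((b ^ (n ∸ toℕ l)) * ((d ^ toℕ l) * μ (toℕ l))))

  1≉0 : ¬ (1# ≈ 0#)
  1≉0 p = charZero 0 (trans (+-identityʳ 1#) p)

  γ₁ : UpperTri
  γ₁ = upperTri 1# 1# 1# 1≉0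

{-# OPTIONS --safe #-}
-- With a = d = 1 every power of a, b, d is 1, so μ|γ₁ is the binomial transform
-- (Tμ)(n) = Σ_{l ≤ n} (n choose l) μ(l), independent of k. Hence
-- (Tμ − μ)(n) = Σ_{l < n} (n choose l) μ(l) is lower triangular: it vanishes at 0,
-- its value at n+1 only involves μ(0), …, μ(n), and μ(n) enters with the invertible
-- coefficient n+1. Triangularity gives everything: injectivity of T − 1, the strict
-- increase of ord_w, and surjectivity onto {ν(0) = 0} by solving for μ(n) recursively.
module Submission where

open import Defs
open import Data.Nat using (ℕ; suc; _<_)
open import Data.Nat.Combinatorics using (_C_)
open import Data.Fin using (Fin; toℕ)
open import Data.Integer using (ℤ)
open import Data.Product using (Σ; _×_)

open import Algebra.Bundles using (Semiring)
open import Data.Nat using (zero; _≤_; _∸_; _≟_; _≤?_)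
open import Data.Nat.Properties using (n≤1+n; m+n∸n≡m; <-≤-trans; ≰⇒>)
open import Data.Nat.Combinatorics using (nCn≡1; nC1≡n; nCk≡nC[n∸k])
open import Data.Nat.Induction using (<-rec)
open import Data.Fin using (fromℕ; lower₁)
open import Data.Fin.Properties using (toℕ-inject₁; toℕ-fromℕ; toℕ-lower₁; toℕ<n)
open import Data.Integer as ℤ using (+_; -[1+_])
open import Data.Product using (_,_; proj₁; proj₂)
open import Function using (_∘_)
open import Relation.Binary.Bundles using (Setoid)
open import Relation.Binary.PropositionalEquality as ≡ using (_≡_)
open import Relation.Nullary using (¬_; yes; no; contradiction)
import Algebra.Definitions.RawMonoid as RawMonoidDefs
import Algebra.Properties.AbelianGroup as AbelianGroupProperties
import Algebra.Properties.Monoid.Sum as MonoidSum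
import Relation.Binary.Reasoning.Setoid as SetoidReasoning

[1+n]Cn≡1+n : ∀ n → suc n C n ≡ suc n
[1+n]Cn≡1+n n = begin
  suc n C n             ≡⟨ nCk≡nC[n∸k] (n≤1+n n) ⟩
  suc n C (suc n ∸ n)   ≡⟨ ≡.cong (suc n C_) (m+n∸n≡m 1 n) ⟩
  suc n C 1             ≡⟨ nC1≡n (suc n) ⟩
  suc n                 ∎
  where open ≡.≡-Reasoning

module CourseOfValues {a ℓ} (S : Setoid a ℓ) where
  open Setoid S

  courseOfValues : (next : (n : ℕ) → (Fin n → Carrier) → Carrier) →
                   (∀ n {h h′} → (∀ i → h i ≈ h′ i) → next n h ≈ next n h′) →
                   Σ (ℕ → Carrier) λ μ → ∀ n → μ n ≈ next n (μ ∘ toℕ)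
  courseOfValues next next-cong = μ , λ n → next-cong n (reflexive ∘ table-correct n)
    where
    table : (n : ℕ) → Fin n → Carrier
    table (suc n) i with n ≟ toℕ i
    ... | yes _ = next n (table n)
    ... | no n≢i = table n (lower₁ i n≢i)

    μ : ℕ → Carrier
    μ n = next n (table n)

    table-correct : ∀ n (i : Fin n) → table n i ≡ μ (toℕ i)
    table-correct (suc n) i with n ≟ toℕ i
    ... | yes n≡i = ≡.cong μ n≡i
    ... | no n≢i = ≡.trans
                     (table-correct n (lower₁ i n≢i)) (≡.cong μ (toℕ-lower₁ i n≢i))

module BinomialTransform {c ℓ} (R : Semiring c ℓ) where
  open Semiring R
  open RawMonoidDefs +-rawMonoid using (sum) renaming (_×_ to _·_)
  open MonoidSum +-monoid using (sum-init-last; sum-cong-≋; sum-cong-≗; sum-replicate-zero)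
  open SetoidReasoning setoid

  sumBelow : ℕ → (ℕ → Carrier) → Carrier
  sumBelow n f = sum (λ (i : Fin n) → f (toℕ i))

  sumBelow-cong : ∀ n {f g} → (∀ l → l < n → f l ≈ g l) → sumBelow n f ≈ sumBelow n g
  sumBelow-cong n f≈g = sum-cong-≋ (λ i → f≈g (toℕ i) (toℕ<n i))

  sumBelow-suc : ∀ n f → sumBelow (suc n) f ≈ sumBelow n f + f n
  sumBelow-suc n f = trans (sum-init-last (λ i → f (toℕ i)))
    (+-cong (reflexive (sum-cong-≗ {n} λ i → ≡.cong f (toℕ-inject₁ i)))
            (reflexive (≡.cong f (toℕ-fromℕ n))))

  sumBelow-≈0 : ∀ n f → (∀ l → l < n → f l ≈ 0#) → sumBelow n f ≈ 0#
  sumBelow-≈0 n f f≈0 = trans (sumBelow-cong n f≈0) (sum-replicate-zero n)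

  binom : ℕ → ℕ → Carrier
  binom n l = (n C l) · 1#

  binomialTransform : (ℕ → Carrier) → ℕ → Carrier
  binomialTransform μ n = sumBelow (suc n) (λ l → binom n l * μ l)

  binomialDifference : (ℕ → Carrier) → ℕ → Carrier
  binomialDifference μ n = sumBelow n (λ l → binom n l * μ l)

  binomialTransform≈id+difference : ∀ μ n →
    binomialTransform μ n ≈ μ n + binomialDifference μ n
  binomialTransform≈id+difference μ n = begin
    binomialTransform μ n                       ≈⟨ sumBelow-suc n (λ l → binom n l * μ l) ⟩
    binomialDifference μ n + binom n n * μ n    ≈⟨ +-congˡ leading ⟩
    binomialDifference μ n + μ n                ≈⟨ +-comm _ _ ⟩
    μ n + binomialDifference μ n                ∎
    where
    leading : binom n n * μ n ≈ μ n
    leading = begin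
      binom n n * μ n ≈⟨ *-congʳ (reflexive (≡.cong (_· 1#) (nCn≡1 n))) ⟩
      (1 · 1#) * μ n  ≈⟨ *-congʳ (+-identityʳ 1#) ⟩
      1# * μ n        ≈⟨ *-identityˡ (μ n) ⟩
      μ n             ∎

  binomialDifference-suc : ∀ μ n → binomialDifference μ (suc n) ≈
    sumBelow n (λ l → binom (suc n) l * μ l) + (suc n · 1#) * μ n
  binomialDifference-suc μ n = trans (sumBelow-suc n (λ l → binom (suc n) l * μ l))
    (+-congˡ (*-congʳ (reflexive (≡.cong (_· 1#) ([1+n]Cn≡1+n n)))))

  binomialDifference-vanishes : ∀ μ {m} n → (∀ l → l < m → μ l ≈ 0#) → n ≤ m →
                                binomialDifference μ n ≈ 0#
  binomialDifference-vanishes μ n μ≈0 n≤m =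
    sumBelow-≈0 n (λ l → binom n l * μ l) λ l l<n →
      trans (*-congˡ (μ≈0 l (<-≤-trans l<n n≤m))) (zeroʳ _)

  binomialDifference-leading : ∀ μ n → (∀ l → l < n → μ l ≈ 0#) →
                               binomialDifference μ (suc n) ≈ (suc n · 1#) * μ n
  binomialDifference-leading μ n μ≈0 = begin
    binomialDifference μ (suc n)  ≈⟨ binomialDifference-suc μ n ⟩
    lower + (suc n · 1#) * μ n    ≈⟨ +-congʳ lower≈0 ⟩
    0# + (suc n · 1#) * μ n       ≈⟨ +-identityˡ _ ⟩
    (suc n · 1#) * μ n            ∎
    where
    lower : Carrier
    lower = sumBelow n (λ l → binom (suc n) l * μ l)

    lower≈0 : lower ≈ 0#
    lower≈0 = sumBelow-≈0 n (λ l → binom (suc n) l * μ l) λ l l<n →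
      trans (*-congˡ (μ≈0 l l<n)) (zeroʳ _)

module TranslationAction {c ℓ} (F : CharZeroField c ℓ) where
  open CharZeroField F
  open Dist F
  open BinomialTransform semiring
  open AbelianGroupProperties +-abelianGroup using (xyx⁻¹≈y; x≈y⇒x∙y⁻¹≈ε; x∙y⁻¹≈ε⇒x≈y)
  open SetoidReasoning setoid

  ≈1⇒^≈1 : ∀ {x} n → x ≈ 1# → x ^ n ≈ 1#
  ≈1⇒^≈1 zero    x≈1 = refl
  ≈1⇒^≈1 (suc n) x≈1 = trans (*-cong x≈1 (≈1⇒^≈1 n x≈1)) (*-identityˡ 1#)

  ≈1⇒*≈ : ∀ {x y} → x ≈ 1# → x * y ≈ y
  ≈1⇒*≈ {y = y} x≈1 = trans (*-congʳ x≈1) (*-identityˡ y)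

  zpow-1# : ∀ e → zpow 1# 1≉0 e ≈ 1#
  zpow-1# (+ n)    = ≈1⇒^≈1 n refl
  zpow-1# -[1+ n ] = ≈1⇒^≈1 (suc n)
    (trans (sym (*-identityˡ _)) (proj₂ (inverse 1# 1≉0)))

  slash-γ₁ : ∀ k μ n → slash k γ₁ μ n ≈ binomialTransform μ n
  slash-γ₁ k μ n = sum-cong-≋ {suc n} term
    where
    open MonoidSum +-monoid using (sum-cong-≋)

    term : ∀ (l : Fin (suc n)) →
      (binom n (toℕ l) * zpow 1# 1≉0 (k ℤ.- + 2 ℤ.- + n))
        * ((1# ^ (n ∸ toℕ l)) * ((1# ^ toℕ l) * μ (toℕ l)))
      ≈ binom n (toℕ l) * μ (toℕ l)
    term l = *-cong
      (trans (*-congˡ (zpow-1# (k ℤ.- + 2 ℤ.- + n))) (*-identityʳ _))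
      (trans (≈1⇒*≈ (≈1⇒^≈1 (n ∸ toℕ l) refl)) (≈1⇒*≈ (≈1⇒^≈1 (toℕ l) refl)))

  slash-γ₁-difference : ∀ k μ n → slash k γ₁ μ n - μ n ≈ binomialDifference μ n
  slash-γ₁-difference k μ n = trans
    (+-congʳ (trans (slash-γ₁ k μ n) (binomialTransform≈id+difference μ n)))
    (xyx⁻¹≈y (μ n) (binomialDifference μ n))

  x≉0∧x*y≈0⇒y≈0 : ∀ {x y} (x≉0 : ¬ x ≈ 0#) → x * y ≈ 0# → y ≈ 0#
  x≉0∧x*y≈0⇒y≈0 {x} {y} x≉0 xy≈0 = begin
    y                 ≈⟨ sym (*-identityˡ y) ⟩
    1# * y            ≈⟨ *-congʳ (sym (proj₂ (inverse x x≉0))) ⟩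
    (x * x⁻¹) * y     ≈⟨ *-congʳ (*-comm x x⁻¹) ⟩
    (x⁻¹ * x) * y     ≈⟨ *-assoc x⁻¹ x y ⟩
    x⁻¹ * (x * y)     ≈⟨ *-congˡ xy≈0 ⟩
    x⁻¹ * 0#          ≈⟨ zeroʳ x⁻¹ ⟩
    0#                ∎
    where
    x⁻¹ : Carrier
    x⁻¹ = proj₁ (inverse x x≉0)

  x*[x⁻¹*y]≈y : ∀ {x} (x≉0 : ¬ x ≈ 0#) y → x * (proj₁ (inverse x x≉0) * y) ≈ y
  x*[x⁻¹*y]≈y x≉0 y = trans (sym (*-assoc _ _ _))
    (trans (*-congʳ (proj₂ (inverse _ x≉0))) (*-identityˡ y))

  binomialDifference-injective : ∀ μ → (∀ n → binomialDifference μ n ≈ 0#) →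
                                 ∀ n → μ n ≈ 0#
  binomialDifference-injective μ Δμ≈0 = <-rec _ λ n μ<n≈0 →
    x≉0∧x*y≈0⇒y≈0 (charZero n)
      (trans (sym (binomialDifference-leading μ n λ l → μ<n≈0)) (Δμ≈0 (suc n)))

  binomialDifference-surjective : ∀ (ν : 𝒟) → ν 0 ≈ 0# →
    Σ 𝒟 λ μ → ∀ n → ν n ≈ binomialDifference μ n
  binomialDifference-surjective ν ν0≈0 =
    proj₁ solution , solves (proj₁ solution) (proj₂ solution)
    where
    [1+n]⁻¹ : ℕ → Carrier
    [1+n]⁻¹ n = proj₁ (inverse (suc n · 1#) (charZero n))

    -- the value of μ(n) forced by binomialDifference μ (n+1) ≈ ν (n+1)
    next : (n : ℕ) → (Fin n → Carrier) → Carrier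
    next n h = [1+n]⁻¹ n * (ν (suc n) - sum (λ i → binom (suc n) (toℕ i) * h i))

    next-cong : ∀ n {h h′} → (∀ i → h i ≈ h′ i) → next n h ≈ next n h′
    next-cong n h≈h′ = *-congˡ (+-congˡ (-‿cong (sum-cong-≋ {n} λ i → *-congˡ (h≈h′ i))))
      where open MonoidSum +-monoid using (sum-cong-≋)

    open CourseOfValues setoid using (courseOfValues)

    solution : Σ 𝒟 λ μ → ∀ n → μ n ≈ next n (μ ∘ toℕ)
    solution = courseOfValues next next-cong

    solves : ∀ μ → (∀ n → μ n ≈ next n (μ ∘ toℕ)) → ∀ n → ν n ≈ binomialDifference μ n
    solves μ μ≈next zero    = ν0≈0
    solves μ μ≈next (suc n) = sym (begin
      binomialDifference μ (suc n)             ≈⟨ binomialDifference-suc μ n ⟩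
      lower + (suc n · 1#) * μ n               ≈⟨ +-congˡ (*-congˡ (μ≈next n)) ⟩
      lower + (suc n · 1#) * next n (μ ∘ toℕ)  ≈⟨ +-congˡ (x*[x⁻¹*y]≈y (charZero n) _) ⟩
      lower + (ν (suc n) - lower)              ≈⟨ sym (+-assoc _ _ _) ⟩
      lower + ν (suc n) - lower                ≈⟨ xyx⁻¹≈y lower (ν (suc n)) ⟩
      ν (suc n)                                ∎)
      where
      lower : Carrier
      lower = sumBelow n (λ l → binom (suc n) l * μ l)

  slash-γ₁-fixed⇒≈0 : ∀ k μ → (∀ n → slash k γ₁ μ n ≈ μ n) → ∀ n → μ n ≈ 0#
  slash-γ₁-fixed⇒≈0 k μ fixed = binomialDifference-injective μ λ n →
    trans (sym (slash-γ₁-difference k μ n)) (x≈y⇒x∙y⁻¹≈ε (fixed n))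

  slash-γ₁-difference-nonzero : ∀ k μ → NonZero𝒟 μ →
                                NonZero𝒟 (λ n → slash k γ₁ μ n - μ n)
  slash-γ₁-difference-nonzero k μ μ≉0 Δμ≈0 =
    μ≉0 (slash-γ₁-fixed⇒≈0 k μ λ n → x∙y⁻¹≈ε⇒x≈y _ _ (Δμ≈0 n))

  slash-γ₁-difference-raises-ord : ∀ k μ m m′ → IsOrd (Cauchy μ) m →
    IsOrd (Cauchy (λ n → slash k γ₁ μ n - μ n)) m′ → m < m′
  slash-γ₁-difference-raises-ord k μ m m′ (_ , μ<m≈0) (Δμm′≉0 , _) with m′ ≤? m
  ... | no m′≰m = ≰⇒> m′≰m
  ... | yes m′≤m = contradiction
    (trans (slash-γ₁-difference k μ m′) (binomialDifference-vanishes μ m′ μ<m≈0 m′≤m))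
    Δμm′≉0

mainTheorem3 : ∀ {c ℓ} (F : CharZeroField c ℓ) →
  let open CharZeroField F
      open Dist F
  in ((k k′ : ℤ) (μ : 𝒟) (n : ℕ) → slash k γ₁ μ n ≈ slash k′ γ₁ μ n)
   × ((k : ℤ) (μ : 𝒟) (n : ℕ) →
        slash k γ₁ μ n ≈ sum (λ (l : Fin (suc n)) → ((n C toℕ l) · 1#) * μ (toℕ l)))
   × ((k : ℤ) (μ : 𝒟) → (∀ n → slash k γ₁ μ n ≈ μ n) → ∀ n → μ n ≈ 0#)
   × ((k : ℤ) (μ : 𝒟) → NonZero𝒟 μ →
        NonZero𝒟 (λ n → slash k γ₁ μ n - μ n)
        × (∀ m m′ → IsOrd (Cauchy μ) m →
             IsOrd (Cauchy (λ n → slash k γ₁ μ n - μ n)) m′ → m < m′))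
   × ((k : ℤ) (ν : 𝒟) →
        ((Σ 𝒟 λ μ → ∀ n → ν n ≈ slash k γ₁ μ n - μ n) → Cauchy ν 0 ≈ 0#)
        × (Cauchy ν 0 ≈ 0# → Σ 𝒟 λ μ → ∀ n → ν n ≈ slash k γ₁ μ n - μ n))
mainTheorem3 F =
    (λ k k′ μ n → trans (slash-γ₁ k μ n) (sym (slash-γ₁ k′ μ n)))
  , slash-γ₁
  , slash-γ₁-fixed⇒≈0
  , (λ k μ μ≉0 → slash-γ₁-difference-nonzero k μ μ≉0
               , slash-γ₁-difference-raises-ord k μ)
  , λ k ν → (λ (μ , ν≈Δμ) → trans (ν≈Δμ 0) (slash-γ₁-difference k μ 0))
          , λ ν0≈0 → let (μ , ν≈Δμ) = binomialDifference-surjective ν ν0≈0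
                     in μ , λ n → trans (ν≈Δμ n) (sym (slash-γ₁-difference k μ n))
  where
  open CharZeroField F
  open TranslationAction F
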